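{- Let $K$ be a $^*$-continuous KAT with top, let $(A,\le_A)$ be a top Kleene abstract domain of $K$ with maps $\alpha:\mathrm{TOP}(K)\to A$ and $\gamma:A\to\mathrm{TOP}(K)$, and let $T_{\Sigma,B}$ be a KAT language interpreted on $K$. For all $p^\sharp,q^\sharp\in A$, $a\in K$ and $t\in T_{\Sigma,B}$: (monotonicity) if $p^\sharp\le_A q^\sharp$ then $\mathcal S^\sharp[t]\,p^\sharp\le_A\mathcal S^\sharp[t]\,q^\sharp$; (soundness) $\alpha(\top a\llbracket t\rrbracket_u)\le_A\mathcal S^\sharp[t]\,\alpha(\top a)$.
   Context: Idempotent semiring: $(K,+,0)$ commutative monoid with $a+a=a$, $(K,\cdot,1)$ monoid, two-sided distributivity, $0a=a0=0$; $a\le b$ iff $a+b=b$. KAT: idempotent semiring with Boolean subalgebra $\mathrm{Test}(K)$ (join $+$, meet $\cdot$, complement, bottom $0$, top $1$) and ${}^*$ with $1+aa^*\le a^*$, $1+a^*a\le a^*$, $b+ac\le c\Rightarrow a^*b\le c$, $b+ca\le c\Rightarrow ba^*\le c$. A TopKAT is a KAT with a greatest element $\top$ ($a\le\top$ for all $a$). It is $^*$-continuous (TopKAT$^*$) if for all $a,b,c\in K$ the lub $\bigvee_{n\in\mathbb N}ab^nc$ exists and equals $ab^*c$. $\mathrm{TOP}(K):=\{\top a\mid a\in K\}$ ordered by $\le$. Language: disjoint $\Sigma,B$ ($\mathtt0,\mathtt1\in B$), $\mathrm{Atom}=\Sigma\cup B$, terms $t::=\mathtt a\mid\mathtt0\mid\mathtt1\mid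 t_1+t_2\mid t_1\cdot t_2\mid t^*$; evaluation $u:\mathrm{Atom}\to K$ with $u(B)\subseteq\mathrm{Test}(K)$, extended homomorphically (sum, product, star) to $\llbracket\cdot\rrbracket_u:T_{\Sigma,B}\to K$. A top Kleene abstract domain of $K$: poset $(A,\le_A)$ with a Galois insertion $\alpha:\mathrm{TOP}(K)\to A$, $\gamma:A\to\mathrm{TOP}(K)$ ($\alpha(x)\le_Ay\iff x\le\gamma(y)$, $\alpha\gamma=\mathrm{id}$) such that every countable subset of $A$ has a lub. Abstract semantics: $\mathcal S^\sharp[\mathtt c]x=\alpha(\gamma(x)\llbracket\mathtt c\rrbracket_u)$ for $\mathtt c\in\mathrm{Atom}$, $\mathcal S^\sharp[t_1+t_2]x=\mathcal S^\sharp[t_1]x\vee_A\mathcal S^\sharp[t_2]x$, $\mathcal S^\sharp[t_1\cdot t_2]x=\mathcal S^\sharp[t_2](\mathcal S^\sharp[t_1]x)$, $\mathcal S^\sharp[t^*]x=\bigvee_n(\mathcal S^\sharp[t])^nx$. -}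

module Defs where

open import Level using (Level; _⊔_) renaming (suc to lsuc)
open import Data.Nat using (ℕ; zero; suc)
open import Data.Product using (Σ; ∃; _,_; proj₁; proj₂)
open import Data.Sum using (_⊎_; inj₁; inj₂)
open import Relation.Binary.PropositionalEquality using (_≡_; refl; cong; sym; trans)
open import Relation.Binary.Bundles using (Poset)
open import Algebra.Structures using (IsIdempotentSemiring)
open import Algebra.Lattice.Structures using (IsBooleanAlgebra)

iterate : ∀ {ℓ} {X : Set ℓ} → (X → X) → ℕ → X → X
iterate f zero x = x
iterate f (suc n) x = f (iterate f n x)

record TopKATStar (c : Level) : Set (lsuc c) where
  infixl 6 _+_
  infixl 7 _·_
  infix 4 _≤_
  field
    Carrier : Set c
    _+_ _·_ : Carrier → Carrier → Carrier
    0# 1# : Carrier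
    _⋆ : Carrier → Carrier
    isIdempotentSemiring : IsIdempotentSemiring _≡_ _+_ _·_ 0# 1#

  _≤_ : Carrier → Carrier → Set c
  a ≤ b = a + b ≡ b

  field
    IsTest : Carrier → Set c
    test-0 : IsTest 0#
    test-1 : IsTest 1#
    test-+ : ∀ {a b} → IsTest a → IsTest b → IsTest (a + b)
    test-· : ∀ {a b} → IsTest a → IsTest b → IsTest (a · b)

  Test : Set c
  Test = Σ Carrier IsTest

  _∨ₜ_ : Test → Test → Test
  x ∨ₜ y = proj₁ x + proj₁ y , test-+ (proj₂ x) (proj₂ y)

  _∧ₜ_ : Test → Test → Test
  x ∧ₜ y = proj₁ x · proj₁ y , test-· (proj₂ x) (proj₂ y)

  _≈ₜ_ : Test → Test → Set c
  x ≈ₜ y = proj₁ x ≡ proj₁ y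

  field
    ¬ₜ : Test → Test
    test-isBooleanAlgebra :
      IsBooleanAlgebra _≈ₜ_ _∨ₜ_ _∧ₜ_ ¬ₜ (1# , test-1) (0# , test-0)

  field
    ⋆-unfoldˡ : ∀ a → 1# + a · (a ⋆) ≤ a ⋆
    ⋆-unfoldʳ : ∀ a → 1# + (a ⋆) · a ≤ a ⋆
    ⋆-inductˡ : ∀ a b c → b + a · c ≤ c → (a ⋆) · b ≤ c
    ⋆-inductʳ : ∀ a b c → b + c · a ≤ c → b · (a ⋆) ≤ c

  field
    ⊤ : Carrier
    ≤-⊤ : ∀ a → a ≤ ⊤

  _^_ : Carrier → ℕ → Carrier
  b ^ n = iterate (b ·_) n 1#

  field
    ⋆-cont-ub : ∀ a b c n → a · (b ^ n) · c ≤ a · (b ⋆) · c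
    ⋆-cont-least : ∀ a b c d → (∀ n → a · (b ^ n) · c ≤ d) → a · (b ⋆) · c ≤ d

  TOP : Set c
  TOP = Σ Carrier (λ x → ∃ λ a → x ≡ ⊤ · a)

  _≤TOP_ : TOP → TOP → Set c
  x ≤TOP y = proj₁ x ≤ proj₁ y

  top : Carrier → TOP
  top a = ⊤ · a , a , refl

  _·TOP_ : TOP → Carrier → TOP
  x ·TOP k = proj₁ x · k , proj₁ (proj₂ x) · k ,
    trans (cong (_· k) (proj₂ (proj₂ x)))
          (IsIdempotentSemiring.*-assoc isIdempotentSemiring ⊤ (proj₁ (proj₂ x)) k)

record TopKleeneAbstractDomain {c : Level} (K : TopKATStar c) (a ℓ₁ ℓ₂ : Level)
       : Set (lsuc (c ⊔ a ⊔ ℓ₁ ⊔ ℓ₂)) where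
  open TopKATStar K
  field
    A : Poset a ℓ₁ ℓ₂
  open Poset A renaming (Carrier to |A|; _≤_ to _≤A_; _≈_ to _≈A_)
  field
    α : TOP → |A|
    γ : |A| → TOP
    galois : ∀ x y → (α x ≤A y → x ≤TOP γ y) Data.Product.× (x ≤TOP γ y → α x ≤A y)
    insertion : ∀ y → α (γ y) ≈A y
    -- every countable subset has a lub: the empty one ...
    ⊥A : |A|
    ⊥A-least : ∀ y → ⊥A ≤A y
    -- ... and every nonempty one (enumerated by a sequence)
    ⋁ : (ℕ → |A|) → |A|
    ⋁-ub : ∀ f n → f n ≤A ⋁ f
    ⋁-least : ∀ f y → (∀ n → f n ≤A y) → ⋁ f ≤A y

  _∨A_ : |A| → |A| → |A|
  x ∨A y = ⋁ (λ { zero → x ; (suc _) → y })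

module _ {s : Level} (Act Bool' : Set s) where
  Atom : Set s
  Atom = Act ⊎ Bool'

data Term {s : Level} (Act Bool' : Set s) : Set s where
  atom : Atom Act Bool' → Term Act Bool'
  _⊕_ : Term Act Bool' → Term Act Bool' → Term Act Bool'
  _⊙_ : Term Act Bool' → Term Act Bool' → Term Act Bool'
  _✶ : Term Act Bool' → Term Act Bool'

record Interpretation {c s : Level} (K : TopKATStar c) (Act Bool' : Set s)
       (𝟘 𝟙 : Bool') : Set (c ⊔ s) where
  open TopKATStar K
  field
    u : Atom Act Bool' → Carrier
    u-test : ∀ b → IsTest (u (inj₂ b))
    u-𝟘 : u (inj₂ 𝟘) ≡ 0#
    u-𝟙 : u (inj₂ 𝟙) ≡ 1#

module Semantics {c s : Level} {K : TopKATStar c} {Act Bool' : Set s} {𝟘 𝟙 : Bool'}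
                 (I : Interpretation K Act Bool' 𝟘 𝟙) where
  open TopKATStar K
  open Interpretation I

  ⟦_⟧ : Term Act Bool' → Carrier
  ⟦ atom x ⟧ = u x
  ⟦ t₁ ⊕ t₂ ⟧ = ⟦ t₁ ⟧ + ⟦ t₂ ⟧
  ⟦ t₁ ⊙ t₂ ⟧ = ⟦ t₁ ⟧ · ⟦ t₂ ⟧
  ⟦ t ✶ ⟧ = ⟦ t ⟧ ⋆

  module Abstract {a ℓ₁ ℓ₂ : Level} (D : TopKleeneAbstractDomain K a ℓ₁ ℓ₂) where
    open TopKleeneAbstractDomain D
    open Poset A renaming (Carrier to |A|)

    S♯ : Term Act Bool' → |A| → |A|
    S♯ (atom c) x = α (γ x ·TOP u c)
    S♯ (t₁ ⊕ t₂) x = S♯ t₁ x ∨A S♯ t₂ x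
    S♯ (t₁ ⊙ t₂) x = S♯ t₂ (S♯ t₁ x)
    S♯ (t ✶) x = ⋁ (λ n → iterate (S♯ t) n x)

{-# OPTIONS --safe #-}
-- Soundness is proved on the concrete side: by the Galois connection
-- it suffices that y ≤ γ p implies y⟦t⟧ ≤ γ(S♯[t] p) for every y ∈ K, which holds by
-- induction on t. For t* the *-continuity of K makes y⟦t⟧* the lub of the y⟦t⟧ⁿ, and
-- each of these is bounded by γ of the n-th iterate of S♯[t] at p.
module Submission where

open import Data.Nat using (ℕ; zero; suc)
open import Data.Product using (_×_; _,_; proj₁; proj₂)
open import Relation.Binary.Bundles using (Poset)
open import Relation.Binary.Structures using (IsPartialOrder)
open import Relation.Binary.PropositionalEquality
  using (_≡_; refl; cong; sym; trans; isEquivalence)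
open import Algebra.Structures using (IsIdempotentSemiring)
import Relation.Binary.Reasoning.PartialOrder as PartialOrderReasoning

open import Defs

iterate-preserves : ∀ {ℓ r} {X : Set ℓ} (_R_ : X → X → Set r) {f : X → X} →
                    (∀ {x y} → x R y → f x R f y) →
                    ∀ n {x y} → x R y → iterate f n x R iterate f n y
iterate-preserves _R_ f-pres zero    xRy = xRy
iterate-preserves _R_ f-pres (suc n) xRy = f-pres (iterate-preserves _R_ f-pres n xRy)

module IdempotentSemiringOrder
  {c} {S : Set c} {_+_ _·_ : S → S → S} {0# 1# : S}
  (isIdempotentSemiring : IsIdempotentSemiring _≡_ _+_ _·_ 0# 1#) where

  open IsIdempotentSemiring isIdempotentSemiring
    using (+-assoc; +-comm; +-idem; distribʳ; *-assoc; *-identityˡ; *-identityʳ)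

  infix 4 _≤_
  _≤_ : S → S → Set c
  a ≤ b = a + b ≡ b

  ≤-trans : ∀ {a b d} → a ≤ b → b ≤ d → a ≤ d
  ≤-trans {a} {b} {d} a≤b b≤d = begin
    a + d       ≡⟨ cong (a +_) b≤d ⟨
    a + (b + d) ≡⟨ +-assoc a b d ⟨
    (a + b) + d ≡⟨ cong (_+ d) a≤b ⟩
    b + d       ≡⟨ b≤d ⟩
    d           ∎
    where open Relation.Binary.PropositionalEquality.≡-Reasoning

  ≤-isPartialOrder : IsPartialOrder _≡_ _≤_
  ≤-isPartialOrder = record
    { isPreorder = record
      { isEquivalence = isEquivalence
      ; reflexive     = λ { {a} refl → +-idem a }
      ; trans         = ≤-trans
      }
    ; antisym = λ {a} {b} a≤b b≤a → trans (sym b≤a) (trans (+-comm b a) a≤b)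
    }

  ≤-poset : Poset c c c
  ≤-poset = record { isPartialOrder = ≤-isPartialOrder }

  +-lub : ∀ {a b d} → a ≤ d → b ≤ d → a + b ≤ d
  +-lub {a} {b} {d} a≤d b≤d = trans (+-assoc a b d) (trans (cong (a +_) b≤d) a≤d)

  ·-monoˡ-≤ : ∀ k {a b} → a ≤ b → a · k ≤ b · k
  ·-monoˡ-≤ k {a} {b} a≤b = trans (sym (distribʳ k a b)) (cong (_· k) a≤b)

  infixr 8 _^_
  _^_ : S → ℕ → S
  b ^ n = iterate (b ·_) n 1#

  ^-sucʳ : ∀ b n → b ^ suc n ≡ (b ^ n) · b
  ^-sucʳ b zero    = trans (*-identityʳ b) (sym (*-identityˡ b))
  ^-sucʳ b (suc n) = trans (cong (b ·_) (^-sucʳ b n)) (sym (*-assoc b (b ^ n) b))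

module AbstractDomainProperties
  {c a ℓ₁ ℓ₂} {K : TopKATStar c} (D : TopKleeneAbstractDomain K a ℓ₁ ℓ₂) where

  open TopKATStar K using (_≤TOP_; isIdempotentSemiring)
  open IdempotentSemiringOrder isIdempotentSemiring using (≤-trans)
  open TopKleeneAbstractDomain D
  open Poset A using ()
    renaming (_≤_ to _≤A_; refl to ≤A-refl; trans to ≤A-trans; reflexive to ≤A-reflexive)

  α-γ-extensive : ∀ x → x ≤TOP γ (α x)
  α-γ-extensive x = proj₁ (galois x (α x)) ≤A-refl

  γ-mono : ∀ {p q} → p ≤A q → γ p ≤TOP γ q
  γ-mono {p} {q} p≤q = proj₁ (galois (γ p) q) (≤A-trans (≤A-reflexive (insertion p)) p≤q)

  α-mono : ∀ {x y} → x ≤TOP y → α x ≤A α y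
  α-mono {x} {y} x≤y = proj₂ (galois x (α y)) (≤-trans x≤y (α-γ-extensive y))

  ⋁-mono : ∀ {f g} → (∀ n → f n ≤A g n) → ⋁ f ≤A ⋁ g
  ⋁-mono f≤g = ⋁-least _ _ λ n → ≤A-trans (f≤g n) (⋁-ub _ n)

  p≤p∨Aq : ∀ p q → p ≤A p ∨A q
  p≤p∨Aq p q = ⋁-ub _ zero

  q≤p∨Aq : ∀ p q → q ≤A p ∨A q
  q≤p∨Aq p q = ⋁-ub _ (suc zero)

  ∨A-mono : ∀ {p p′ q q′} → p ≤A p′ → q ≤A q′ → p ∨A q ≤A p′ ∨A q′
  ∨A-mono p≤p′ q≤q′ = ⋁-mono λ { zero → p≤p′ ; (suc _) → q≤q′ }

module AbstractSemanticsProperties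
  {c a ℓ₁ ℓ₂ s} {K : TopKATStar c} (D : TopKleeneAbstractDomain K a ℓ₁ ℓ₂)
  {Act Bool' : Set s} {𝟘 𝟙 : Bool'} (I : Interpretation K Act Bool' 𝟘 𝟙) where

  open TopKATStar K hiding (_≤_; _^_)
  open IsIdempotentSemiring isIdempotentSemiring using (distribˡ; *-assoc; *-identityʳ)
  open IdempotentSemiringOrder isIdempotentSemiring
  open TopKleeneAbstractDomain D
  open Poset A using () renaming (_≤_ to _≤A_)
  open AbstractDomainProperties D
  open Interpretation I
  open Semantics I
  open Abstract D
  open PartialOrderReasoning ≤-poset

  S♯-mono : ∀ t {p q} → p ≤A q → S♯ t p ≤A S♯ t q
  S♯-mono (atom x)  p≤q = α-mono (·-monoˡ-≤ (u x) (γ-mono p≤q))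
  S♯-mono (t₁ ⊕ t₂) p≤q = ∨A-mono (S♯-mono t₁ p≤q) (S♯-mono t₂ p≤q)
  S♯-mono (t₁ ⊙ t₂) p≤q = S♯-mono t₂ (S♯-mono t₁ p≤q)
  S♯-mono (t ✶)     p≤q = ⋁-mono λ n → iterate-preserves _≤A_ (S♯-mono t) n p≤q

  S♯-sound : ∀ t {y p} → y ≤ proj₁ (γ p) → y · ⟦ t ⟧ ≤ proj₁ (γ (S♯ t p))
  S♯-sound (atom x) {y} {p} y≤γp = begin
    y · u x                            ≤⟨ ·-monoˡ-≤ (u x) y≤γp ⟩
    proj₁ (γ p) · u x                  ≤⟨ α-γ-extensive (γ p ·TOP u x) ⟩
    proj₁ (γ (α (γ p ·TOP u x)))       ∎
  S♯-sound (t₁ ⊕ t₂) {y} {p} y≤γp = begin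
    y · (⟦ t₁ ⟧ + ⟦ t₂ ⟧)              ≡⟨ distribˡ y ⟦ t₁ ⟧ ⟦ t₂ ⟧ ⟩
    y · ⟦ t₁ ⟧ + y · ⟦ t₂ ⟧            ≤⟨ +-lub (into-join t₁ (p≤p∨Aq _ _)) (into-join t₂ (q≤p∨Aq _ _)) ⟩
    proj₁ (γ (S♯ (t₁ ⊕ t₂) p))         ∎
    where
    into-join : ∀ t → S♯ t p ≤A S♯ (t₁ ⊕ t₂) p → y · ⟦ t ⟧ ≤ proj₁ (γ (S♯ (t₁ ⊕ t₂) p))
    into-join t St≤join = ≤-trans (S♯-sound t y≤γp) (γ-mono St≤join)
  S♯-sound (t₁ ⊙ t₂) {y} {p} y≤γp = begin
    y · (⟦ t₁ ⟧ · ⟦ t₂ ⟧)              ≡⟨ *-assoc y ⟦ t₁ ⟧ ⟦ t₂ ⟧ ⟨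
    (y · ⟦ t₁ ⟧) · ⟦ t₂ ⟧              ≤⟨ S♯-sound t₂ (S♯-sound t₁ y≤γp) ⟩
    proj₁ (γ (S♯ t₂ (S♯ t₁ p)))        ∎
  S♯-sound (t ✶) {y} {p} y≤γp = begin
    y · ⟦ t ⟧ ⋆                        ≡⟨ *-identityʳ (y · ⟦ t ⟧ ⋆) ⟨
    y · ⟦ t ⟧ ⋆ · 1#                   ≤⟨ ⋆-cont-least y ⟦ t ⟧ 1# _ power-sound ⟩
    proj₁ (γ (S♯ (t ✶) p))             ∎
    where
    iterate-sound : ∀ n → y · ⟦ t ⟧ ^ n ≤ proj₁ (γ (iterate (S♯ t) n p))
    iterate-sound zero    = begin
      y · ⟦ t ⟧ ^ zero                     ≡⟨ *-identityʳ y ⟩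
      y                                    ≤⟨ y≤γp ⟩
      proj₁ (γ p)                          ∎
    iterate-sound (suc n) = begin
      y · ⟦ t ⟧ ^ suc n                    ≡⟨ cong (y ·_) (^-sucʳ ⟦ t ⟧ n) ⟩
      y · (⟦ t ⟧ ^ n · ⟦ t ⟧)              ≡⟨ *-assoc y (⟦ t ⟧ ^ n) ⟦ t ⟧ ⟨
      y · ⟦ t ⟧ ^ n · ⟦ t ⟧                ≤⟨ S♯-sound t (iterate-sound n) ⟩
      proj₁ (γ (iterate (S♯ t) (suc n) p)) ∎
    power-sound : ∀ n → y · ⟦ t ⟧ ^ n · 1# ≤ proj₁ (γ (S♯ (t ✶) p))
    power-sound n = begin
      y · ⟦ t ⟧ ^ n · 1#                   ≡⟨ *-identityʳ (y · ⟦ t ⟧ ^ n) ⟩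
      y · ⟦ t ⟧ ^ n                        ≤⟨ iterate-sound n ⟩
      proj₁ (γ (iterate (S♯ t) n p))       ≤⟨ γ-mono (⋁-ub _ n) ⟩
      proj₁ (γ (S♯ (t ✶) p))               ∎

  S♯-overapproximates : ∀ t x → α (x ·TOP ⟦ t ⟧) ≤A S♯ t (α x)
  S♯-overapproximates t x = proj₂ (galois _ _) (S♯-sound t (α-γ-extensive x))

theorem8 : ∀ {c a ℓ₁ ℓ₂ s} (K : TopKATStar c) (D : TopKleeneAbstractDomain K a ℓ₁ ℓ₂)
             {Act Bool' : Set s} {𝟘 𝟙 : Bool'} (I : Interpretation K Act Bool' 𝟘 𝟙) →
           -- monotonicity
           (∀ (p q : Poset.Carrier (TopKleeneAbstractDomain.A D)) (t : Term Act Bool') →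
              Poset._≤_ (TopKleeneAbstractDomain.A D) p q →
              Poset._≤_ (TopKleeneAbstractDomain.A D)
                (Semantics.Abstract.S♯ I D t p) (Semantics.Abstract.S♯ I D t q))
           ×
           -- soundness: α(⊤a⟦t⟧) ≤ S♯[t] α(⊤a)
           (∀ (x : TopKATStar.Carrier K) (t : Term Act Bool') →
              Poset._≤_ (TopKleeneAbstractDomain.A D)
                (TopKleeneAbstractDomain.α D (TopKATStar._·TOP_ K (TopKATStar.top K x) (Semantics.⟦_⟧ I t)))
                (Semantics.Abstract.S♯ I D t (TopKleeneAbstractDomain.α D (TopKATStar.top K x))))
theorem8 K D I =
  (λ p q t → S♯-mono t) , (λ x t → S♯-overapproximates t (TopKATStar.top K x))
  where open AbstractSemanticsProperties D I
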